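{- Consider unrelated machines $1,\dots,m$ and jobs $1,\dots,n$, where job $j$ has processing time $p_{ij}$ on machine $i$, release date $r_j$ and deadline $d_j$, and let $c:\{1,\dots,n\}\to\{1,\dots,k\}$ be a coloring of the jobs. For a machine $i$ and $X\subseteq\{1,\dots,k\}$, let $B_i(X)$ be the minimum makespan over all feasible schedules on machine $i$ alone that process exactly $|X|$ jobs, each of a different color in $X$ (with $B_i(\emptyset)=0$, and $B_i(X)=\infty$ if no such schedule exists). Then, with the convention $\min\emptyset=\infty$, $$B_i(X) = \min_{l \in X}\ \min_{j:\, c(j)=l}\big\{ C_j : C_j=\max\{r_j, B_i(X\setminus\{l\})\} + p_{ij},\ C_j \le d_j\big\}.$$
   Context: A feasible schedule on a single machine $i$ processes the chosen jobs non-preemptively one at a time, each job $j$ starting no earlier than $r_j$, taking time $p_{ij}$ and completing no later than $d_j$. Its makespan is the maximum completion time. -}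

module Defs where

open import Data.Nat using (ℕ; _≤_; _≤?_; _+_; _⊔_)
open import Data.Fin using (Fin)
open import Data.Fin.Subset using (Subset; _∈_; _-_; ∣_∣)
open import Data.Fin.Subset.Properties using (_∈?_)
open import Data.Fin.Properties using (_≟_)
open import Data.List using (List; []; _∷_; map; length; allFin; filter; foldr; concatMap)
open import Data.List.Relation.Unary.All using (All)
open import Data.List.Relation.Unary.Unique.Propositional using (Unique)
open import Data.Maybe using (Maybe; just; nothing)
open import Data.Product using (_×_; _,_; proj₁; Σ)
open import Data.Unit using (⊤)
open import Relation.Binary.PropositionalEquality using (_≡_)
open import Relation.Nullary using (¬_; yes; no)

-- Extended naturals: `just t` is a finite time t, `nothing` is ∞.
ℕ∞ : Set
ℕ∞ = Maybe ℕ

_⊓∞_ : ℕ∞ → ℕ∞ → ℕ∞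
nothing ⊓∞ y = y
just a ⊓∞ nothing = just a
just a ⊓∞ just b = just (a Data.Nat.⊓ b)

min∞ : List ℕ∞ → ℕ∞
min∞ = foldr _⊓∞_ nothing

module Scheduling
  {m n k : ℕ}
  (p : Fin m → Fin n → ℕ)
  (r : Fin n → ℕ)
  (d : Fin n → ℕ)
  (c : Fin n → Fin k)
  where

  -- A single-machine schedule: the chosen jobs in processing order,
  -- each paired with its start time.
  Schedule : Set
  Schedule = List (Fin n × ℕ)

  FeasibleFrom : Fin m → ℕ → Schedule → Set
  FeasibleFrom i t [] = ⊤
  FeasibleFrom i t ((j , s) ∷ σ) =
    t ≤ s × r j ≤ s × s + p i j ≤ d j × FeasibleFrom i (s + p i j) σ

  Feasible : Fin m → Schedule → Set
  Feasible i σ = FeasibleFrom i 0 σ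

  -- Makespan = maximum completion time (completion times are
  -- nondecreasing along the processing order, so this is the last one);
  -- the empty schedule has makespan 0.
  makespanFrom : Fin m → ℕ → Schedule → ℕ
  makespanFrom i t [] = t
  makespanFrom i t ((j , s) ∷ σ) = makespanFrom i (s + p i j) σ

  makespan : Fin m → Schedule → ℕ
  makespan i σ = makespanFrom i 0 σ

  colours : Schedule → List (Fin k)
  colours σ = map (λ js → c (proj₁ js)) σ

  Admissible : Fin m → Subset k → Schedule → Set
  Admissible i X σ =
    Feasible i σ × length σ ≡ ∣ X ∣ × All (_∈ X) (colours σ) × Unique (colours σ)

  IsB : Fin m → Subset k → ℕ∞ → Set
  IsB i X nothing = ∀ σ → ¬ Admissible i X σ
  IsB i X (just v) =
    Σ Schedule (λ σ → Admissible i X σ × makespan i σ ≡ v)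
    × (∀ σ → Admissible i X σ → v ≤ makespan i σ)

  candidate : (Subset k → ℕ∞) → Fin m → Subset k → Fin k → Fin n → ℕ∞
  candidate B i X l j with B (X - l)
  ... | nothing = nothing
  ... | just b with (r j ⊔ b) + p i j ≤? d j
  ...   | yes _ = just ((r j ⊔ b) + p i j)
  ...   | no  _ = nothing

  recurrence : (Subset k → ℕ∞) → Fin m → Subset k → ℕ∞
  recurrence B i X =
    min∞ (map (λ l →
      min∞ (map (candidate B i X l)
                (filter (λ j → c j ≟ l) (allFin n))))
      (filter (_∈? X) (allFin k)))

-- An admissible schedule for a nonempty colour set X ends with some job j of a colour
-- l = c j ∈ X; the jobs before it form an admissible schedule for X ∖ {l}, whose makespan
-- is at least B (X ∖ {l}).  Hence the last job cannot complete before max (r j, B (X ∖ {l})) + p i j,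
-- so B X is at least the right-hand side.  Conversely, appending j at time max (r j, B (X ∖ {l}))
-- to an optimal schedule for X ∖ {l} is admissible for X whenever it meets the deadline, so
-- every finite candidate is attained and B X is at most the right-hand side.
module Submission where

open import Defs
open import Data.Nat using (ℕ; suc; _+_; _≤_; _≤?_; _⊔_)
open import Data.Nat.Properties
  using (+-comm; ≤-trans; ≤-antisym; ⊓-glb; m≤n⇒m⊓n≡m; m≥n⇒m⊓n≡n; m≤m⊔n; m≤n⊔m; ⊔-lub; +-monoˡ-≤; suc-injective)
open import Data.Fin using (Fin; suc)
open import Data.Fin.Subset using (Subset; Nonempty; _∈_; _∉_; _-_; ∣_∣; inside; outside; ⁅_⁆)
open import Data.Fin.Subset.Properties using (_∈?_; p─⊥≡p; p─q⊆p; x∈p∧x≢y⇒x∈p-y)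
open import Data.Fin.Properties using (_≟_)
open import Data.Vec.Base using (here; there)
import Data.Vec.Base as Vec
open import Data.List using (List; []; _∷_; _++_; [_]; _∷ʳ_; map; length; allFin; filter; initLast; _∷ʳ′_)
import Data.List.Membership.Propositional as List
open import Data.List.Membership.Propositional.Properties using (∈-filter⁺; ∈-filter⁻; ∈-allFin; ∈-map⁺)
open import Data.List.Properties using (map-++; length-++)
open import Data.List.Relation.Unary.All as All using (All; []; _∷_)
import Data.List.Relation.Unary.All.Properties as All
open import Data.List.Relation.Unary.Any using (here; there)
open import Data.List.Relation.Unary.AllPairs using ([]; _∷_)
open import Data.List.Relation.Unary.Unique.Propositional using (Unique)
import Data.List.Relation.Unary.Unique.Propositional.Properties as Unique
open import Data.Maybe using (just; nothing)
open import Data.Maybe.Properties using (just-injective)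
open import Data.Product using (∃-syntax; _×_; _,_; proj₂)
open import Data.Unit using (⊤; tt)
open import Function using (_∘_)
open import Data.Empty using (⊥-elim)
open import Relation.Nullary using (¬_; yes; no)
open import Relation.Binary.PropositionalEquality using (_≡_; refl; sym; trans; cong; subst; module ≡-Reasoning)

private
  variable
    A A′ : Set

x∈p⇒∣p∣≡1+∣p-x∣ : ∀ {k} (X : Subset k) {x} → x ∈ X → ∣ X ∣ ≡ suc ∣ X - x ∣
x∈p⇒∣p∣≡1+∣p-x∣ (inside  Vec.∷ X) here      = cong suc (cong ∣_∣ (sym (p─⊥≡p X)))
x∈p⇒∣p∣≡1+∣p-x∣ (inside  Vec.∷ X) (there x∈X) = cong suc (x∈p⇒∣p∣≡1+∣p-x∣ X x∈X)
x∈p⇒∣p∣≡1+∣p-x∣ (outside Vec.∷ X) (there x∈X) = x∈p⇒∣p∣≡1+∣p-x∣ X x∈X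

x∉p-x : ∀ {k} {X : Subset k} {x} → x ∉ X - x
x∉p-x {X = _ Vec.∷ X} {suc x} (there x∈X-x) = x∉p-x {X = X} x∈X-x

All-∈-remove : ∀ {k} {X : Subset k} {x} {xs : List (Fin k)} →
               All (_∈ X) xs → ¬ x List.∈ xs → All (_∈ X - x) xs
All-∈-remove []         x∉xs = []
All-∈-remove (y∈X ∷ ys) x∉xs =
  x∈p∧x≢y⇒x∈p-y y∈X (λ { refl → x∉xs (here refl) }) ∷ All-∈-remove ys (x∉xs ∘ there)

length-∷ʳ : (xs : List A) {x : A} → length (xs ∷ʳ x) ≡ suc (length xs)
length-∷ʳ xs = trans (length-++ xs) (+-comm (length xs) 1)

Unique-∷ʳ⁺ : {xs : List A} {x : A} → Unique xs → ¬ x List.∈ xs → Unique (xs ∷ʳ x)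
Unique-∷ʳ⁺ xs! x∉xs = Unique.++⁺ xs! ([] ∷ []) λ { (x∈xs , here refl) → x∉xs x∈xs }

Unique-∷ʳ⁻ : (xs : List A) {x : A} → Unique (xs ∷ʳ x) → Unique xs × ¬ x List.∈ xs
Unique-∷ʳ⁻ []       _           = [] , λ ()
Unique-∷ʳ⁻ (y ∷ xs) (y∉ ∷ xs!) with Unique-∷ʳ⁻ xs xs!
... | xs!′ , x∉xs = All.++⁻ˡ xs y∉ ∷ xs!′ , λ where
  (here refl)  → All.lookup (All.++⁻ʳ xs y∉) (here refl) refl
  (there x∈xs) → x∉xs x∈xs

_≤∞_ : ℕ → ℕ∞ → Set
v ≤∞ nothing = ⊤
v ≤∞ just w  = v ≤ w

⊓∞-glb : ∀ {v} x y → v ≤∞ x → v ≤∞ y → v ≤∞ (x ⊓∞ y)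
⊓∞-glb nothing  y        _   v≤y = v≤y
⊓∞-glb (just a) nothing  v≤a _   = v≤a
⊓∞-glb (just a) (just b) v≤a v≤b = ⊓-glb v≤a v≤b

⊓∞-selectˡ : ∀ {v} y → v ≤∞ y → just v ⊓∞ y ≡ just v
⊓∞-selectˡ nothing  _   = refl
⊓∞-selectˡ (just b) v≤b = cong just (m≤n⇒m⊓n≡m v≤b)

⊓∞-selectʳ : ∀ {v} x → v ≤∞ x → x ⊓∞ just v ≡ just v
⊓∞-selectʳ nothing  _   = refl
⊓∞-selectʳ (just a) v≤a = cong just (m≥n⇒m⊓n≡n v≤a)

min∞-glb : ∀ {v} (xs : List ℕ∞) → All (v ≤∞_) xs → v ≤∞ min∞ xs
min∞-glb []       []            = tt
min∞-glb (x ∷ xs) (v≤x ∷ v≤xs) = ⊓∞-glb x (min∞ xs) v≤x (min∞-glb xs v≤xs)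

min∞-≡-just : ∀ {v} {xs : List ℕ∞} → just v List.∈ xs → All (v ≤∞_) xs → min∞ xs ≡ just v
min∞-≡-just {xs = _ ∷ xs} (here refl) (_ ∷ v≤xs) = ⊓∞-selectˡ (min∞ xs) (min∞-glb xs v≤xs)
min∞-≡-just {xs = x ∷ xs} (there v∈xs) (v≤x ∷ v≤xs) = begin
  x ⊓∞ min∞ xs ≡⟨ cong (x ⊓∞_) (min∞-≡-just v∈xs v≤xs) ⟩
  x ⊓∞ just _  ≡⟨ ⊓∞-selectʳ x v≤x ⟩
  just _       ∎
  where open ≡-Reasoning

min∞-≡-nothing : {xs : List ℕ∞} → All (_≡ nothing) xs → min∞ xs ≡ nothing
min∞-≡-nothing []         = refl
min∞-≡-nothing (refl ∷ ps) = min∞-≡-nothing ps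

All-map : {g : A → ℕ∞} {P : ℕ∞ → Set} {zs : List A} →
          (∀ {z} → z List.∈ zs → P (g z)) → All P (map g zs)
All-map p = All.map⁺ (All.tabulate p)

nestedMin∞ : (A → A′ → ℕ∞) → (A → List A′) → List A → ℕ∞
nestedMin∞ f ys xs = min∞ (map (λ a → min∞ (map (f a) (ys a))) xs)

module _ (f : A → A′ → ℕ∞) (ys : A → List A′) (xs : List A) where

  nestedMin∞-≡-nothing : (∀ {a b} → a List.∈ xs → b List.∈ ys a → f a b ≡ nothing) →
                         nestedMin∞ f ys xs ≡ nothing
  nestedMin∞-≡-nothing f≡nothing =
    min∞-≡-nothing (All-map λ a∈xs → min∞-≡-nothing (All-map λ b∈ys → f≡nothing a∈xs b∈ys))

  nestedMin∞-≡-just : ∀ {a b v} → a List.∈ xs → b List.∈ ys a → f a b ≡ just v →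
                      (∀ {a b} → a List.∈ xs → b List.∈ ys a → v ≤∞ f a b) →
                      nestedMin∞ f ys xs ≡ just v
  nestedMin∞-≡-just {a} {b} {v} a∈xs b∈ys fab≡v v≤f =
    min∞-≡-just (subst (List._∈ map inner xs) inner-a≡v (∈-map⁺ inner a∈xs))
                (All-map λ a∈xs → min∞-glb _ (All-map (v≤f a∈xs)))
    where
    inner : A → ℕ∞
    inner a = min∞ (map (f a) (ys a))

    inner-a≡v : inner a ≡ just v
    inner-a≡v = min∞-≡-just (subst (List._∈ map (f a) (ys a)) fab≡v (∈-map⁺ (f a) b∈ys))
                            (All-map (v≤f a∈xs))

module ScheduleProperties {m n k : ℕ}
  (p : Fin m → Fin n → ℕ) (r : Fin n → ℕ) (d : Fin n → ℕ) (c : Fin n → Fin k) where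

  open Scheduling p r d c

  FeasibleFrom-++⁺ : ∀ {i t} σ {τ} → FeasibleFrom i t σ → FeasibleFrom i (makespanFrom i t σ) τ →
                     FeasibleFrom i t (σ ++ τ)
  FeasibleFrom-++⁺ []      _                    τ-ok = τ-ok
  FeasibleFrom-++⁺ (_ ∷ σ) (t≤s , r≤s , ≤d , σ-ok) τ-ok = t≤s , r≤s , ≤d , FeasibleFrom-++⁺ σ σ-ok τ-ok

  FeasibleFrom-++⁻ : ∀ {i t} σ {τ} → FeasibleFrom i t (σ ++ τ) →
                     FeasibleFrom i t σ × FeasibleFrom i (makespanFrom i t σ) τ
  FeasibleFrom-++⁻ []      τ-ok = tt , τ-ok
  FeasibleFrom-++⁻ (_ ∷ σ) (t≤s , r≤s , ≤d , στ-ok) with FeasibleFrom-++⁻ σ στ-ok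
  ... | σ-ok , τ-ok = (t≤s , r≤s , ≤d , σ-ok) , τ-ok

  makespanFrom-++ : ∀ {i t} σ {τ} → makespanFrom i t (σ ++ τ) ≡ makespanFrom i (makespanFrom i t σ) τ
  makespanFrom-++ []      = refl
  makespanFrom-++ (_ ∷ σ) = makespanFrom-++ σ

  colours-∷ʳ : ∀ σ {j s} → colours (σ ∷ʳ (j , s)) ≡ colours σ ∷ʳ c j
  colours-∷ʳ σ = map-++ _ σ _

  Admissible-∷ʳ⁺ : ∀ {i X} σ {j s} → c j ∈ X → Admissible i (X - c j) σ →
                   FeasibleFrom i (makespan i σ) [ (j , s) ] → Admissible i X (σ ∷ʳ (j , s))
  Admissible-∷ʳ⁺ {X = X} σ {j} {s} cj∈X (σ-ok , |σ| , σ⊆X-cj , σ!) js-ok rewrite colours-∷ʳ σ {j} {s} =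
      FeasibleFrom-++⁺ σ σ-ok js-ok
    , trans (length-∷ʳ σ) (trans (cong suc |σ|) (sym (x∈p⇒∣p∣≡1+∣p-x∣ X cj∈X)))
    , All.∷ʳ⁺ (All.map (p─q⊆p X ⁅ c j ⁆) σ⊆X-cj) cj∈X
    , Unique-∷ʳ⁺ σ! (x∉p-x ∘ All.lookup σ⊆X-cj)

  Admissible-∷ʳ⁻ : ∀ {i X} σ {j s} → Admissible i X (σ ∷ʳ (j , s)) →
                   c j ∈ X × Admissible i (X - c j) σ × FeasibleFrom i (makespan i σ) [ (j , s) ]
  Admissible-∷ʳ⁻ {X = X} σ {j} {s} (σj-ok , |σj| , σj⊆X , σj!) rewrite colours-∷ʳ σ {j} {s}
    with All.∷ʳ⁻ σj⊆X | Unique-∷ʳ⁻ (colours σ) σj! | FeasibleFrom-++⁻ σ σj-ok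
  ... | σ⊆X , cj∈X | σ! , cj∉σ | σ-ok , js-ok =
      cj∈X
    , ( σ-ok
      , suc-injective (trans (sym (length-∷ʳ σ)) (trans |σj| (x∈p⇒∣p∣≡1+∣p-x∣ X cj∈X)))
      , All-∈-remove σ⊆X cj∉σ
      , σ! )
    , js-ok

  members : Subset k → List (Fin k)
  members X = filter (_∈? X) (allFin k)

  ∈-members⁺ : ∀ {X l} → l ∈ X → l List.∈ members X
  ∈-members⁺ {X} {l} = ∈-filter⁺ (_∈? X) (∈-allFin l)

  ∈-members⁻ : ∀ {X l} → l List.∈ members X → l ∈ X
  ∈-members⁻ {X} = proj₂ ∘ ∈-filter⁻ (_∈? X) {xs = allFin k}

  colourClass : Fin k → List (Fin n)
  colourClass l = filter (λ j → c j ≟ l) (allFin n)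

  ∈-colourClass⁺ : ∀ j → j List.∈ colourClass (c j)
  ∈-colourClass⁺ j = ∈-filter⁺ (λ j′ → c j′ ≟ c j) (∈-allFin j) refl

  ∈-colourClass⁻ : ∀ {l j} → j List.∈ colourClass l → c j ≡ l
  ∈-colourClass⁻ {l} = proj₂ ∘ ∈-filter⁻ (λ j → c j ≟ l) {xs = allFin n}

  earliestCompletion : Fin m → Fin n → ℕ → ℕ
  earliestCompletion i j t = (r j ⊔ t) + p i j

  earliestStart-feasible : ∀ {i j t} → earliestCompletion i j t ≤ d j →
                           FeasibleFrom i t [ (j , r j ⊔ t) ]
  earliestStart-feasible {j = j} {t} ≤d = m≤n⊔m (r j) t , m≤m⊔n (r j) t , ≤d , tt

  earliestCompletion-≤ : ∀ {i j t s b} → FeasibleFrom i t [ (j , s) ] → b ≤ t →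
                         earliestCompletion i j b ≤ s + p i j
  earliestCompletion-≤ {i} {j} (t≤s , r≤s , _) b≤t = +-monoˡ-≤ (p i j) (⊔-lub r≤s (≤-trans b≤t t≤s))

  module DynamicProgram (i : Fin m) (B : Subset k → ℕ∞) where

    candidate-≡-just⁺ : ∀ {X l j b} → B (X - l) ≡ just b → earliestCompletion i j b ≤ d j →
                        candidate B i X l j ≡ just (earliestCompletion i j b)
    candidate-≡-just⁺ {X} {l} {j} B≡b ≤d with B (X - l) | B≡b
    ... | just b | refl with earliestCompletion i j b ≤? d j
    ...   | yes _  = refl
    ...   | no  ≰d = ⊥-elim (≰d ≤d)

    candidate-≡-just⁻ : ∀ {X l j w} → candidate B i X l j ≡ just w →
                        ∃[ b ] B (X - l) ≡ just b × earliestCompletion i j b ≤ d j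
                               × earliestCompletion i j b ≡ w
    candidate-≡-just⁻ {X} {l} {j} cand≡w with B (X - l)
    ... | just b with earliestCompletion i j b ≤? d j
    ...   | yes ≤d = b , refl , ≤d , just-injective cand≡w

    recurrence-≡-nothing : ∀ {X} → (∀ {l j} → l ∈ X → c j ≡ l → candidate B i X l j ≡ nothing) →
                           recurrence B i X ≡ nothing
    recurrence-≡-nothing {X} cand≡nothing =
      nestedMin∞-≡-nothing (candidate B i X) colourClass (members X)
        λ l∈X j∈l → cand≡nothing (∈-members⁻ l∈X) (∈-colourClass⁻ j∈l)

    recurrence-≡-just : ∀ {X j v} → c j ∈ X → candidate B i X (c j) j ≡ just v →
                        (∀ {l j} → l ∈ X → c j ≡ l → v ≤∞ candidate B i X l j) →
                        recurrence B i X ≡ just v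
    recurrence-≡-just {X} {j} cj∈X cand≡v v≤cand =
      nestedMin∞-≡-just (candidate B i X) colourClass (members X)
        (∈-members⁺ cj∈X) (∈-colourClass⁺ j) cand≡v
        λ l∈X j∈l → v≤cand (∈-members⁻ l∈X) (∈-colourClass⁻ j∈l)

    module _ (isB : ∀ Y → IsB i Y (B Y)) where

      candidate-attained : ∀ {X l j w} → l ∈ X → c j ≡ l → candidate B i X l j ≡ just w →
                           ∃[ σ ] Admissible i X σ × makespan i σ ≡ w
      candidate-attained {X} {j = j} cj∈X refl cand≡w with candidate-≡-just⁻ cand≡w
      ... | b , B≡b , ≤d , refl with subst (IsB i (X - c j)) B≡b (isB (X - c j))
      ...   | (σ , σ-adm , refl) , _ =
        σ ∷ʳ (j , r j ⊔ b) , Admissible-∷ʳ⁺ σ cj∈X σ-adm (earliestStart-feasible ≤d) , makespanFrom-++ σ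

      candidate-≡-nothing : ∀ {X l j} → (∀ σ → ¬ Admissible i X σ) → l ∈ X → c j ≡ l →
                            candidate B i X l j ≡ nothing
      candidate-≡-nothing {X} {l} {j} infeasible l∈X cj≡l with candidate B i X l j in cand≡w
      ... | nothing = refl
      ... | just w with candidate-attained l∈X cj≡l cand≡w
      ...   | σ , σ-adm , _ = ⊥-elim (infeasible σ σ-adm)

      candidate-lowerBound : ∀ {X l j v} → (∀ σ → Admissible i X σ → v ≤ makespan i σ) →
                             l ∈ X → c j ≡ l → v ≤∞ candidate B i X l j
      candidate-lowerBound {X} {l} {j} v≤makespan l∈X cj≡l with candidate B i X l j in cand≡w
      ... | nothing = tt
      ... | just w with candidate-attained l∈X cj≡l cand≡w
      ...   | σ , σ-adm , refl = v≤makespan σ σ-adm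

      lastJob-candidate : ∀ {X σ} → Nonempty X → Admissible i X σ →
                          ∃[ j ] c j ∈ X × ∃[ w ] candidate B i X (c j) j ≡ just w × w ≤ makespan i σ
      lastJob-candidate {X} {σ} (l , l∈X) σ-adm with initLast σ
      lastJob-candidate {X} (l , l∈X) (_ , |[]| , _) | [] with trans |[]| (x∈p⇒∣p∣≡1+∣p-x∣ X l∈X)
      ... | ()
      lastJob-candidate {X} _ σ-adm | σ′ ∷ʳ′ (j , s) with Admissible-∷ʳ⁻ σ′ σ-adm
      ... | cj∈X , σ′-adm , js-ok@(_ , _ , s+p≤d , _) with B (X - c j) in B≡b | isB (X - c j)
      ...   | nothing | infeasible = ⊥-elim (infeasible σ′ σ′-adm)
      ...   | just b  | _ , optimal =
        j , cj∈X , earliestCompletion i j b , candidate-≡-just⁺ B≡b (≤-trans completion≤ s+p≤d) ,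
        subst (earliestCompletion i j b ≤_) (sym (makespanFrom-++ σ′)) completion≤
        where
        completion≤ : earliestCompletion i j b ≤ s + p i j
        completion≤ = earliestCompletion-≤ js-ok (optimal σ′ σ′-adm)

lemma18 : {m n k : ℕ}
    (p : Fin m → Fin n → ℕ) (r : Fin n → ℕ) (d : Fin n → ℕ) (c : Fin n → Fin k)
    (i : Fin m) (B : Subset k → ℕ∞) →
    (∀ Y → Scheduling.IsB p r d c i Y (B Y)) →
    (X : Subset k) → Nonempty X →
    B X ≡ Scheduling.recurrence p r d c B i X
lemma18 p r d c i B isB X X≢∅ = B-satisfies-recurrence
  where
  open Scheduling p r d c using (candidate; recurrence)
  open ScheduleProperties p r d c
  open DynamicProgram i B

  B-satisfies-recurrence : B X ≡ recurrence B i X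
  B-satisfies-recurrence with B X | isB X
  ... | nothing | infeasible =
    sym (recurrence-≡-nothing (candidate-≡-nothing isB infeasible))
  ... | just v | (σ , σ-adm , refl) , optimal
    with lastJob-candidate isB X≢∅ σ-adm
  ...   | j , cj∈X , w , cand≡w , w≤v =
    sym (recurrence-≡-just cj∈X (trans cand≡w (cong just w≡v)) v≤cand)
    where
    v≤cand : ∀ {l j} → l ∈ X → c j ≡ l → v ≤∞ candidate B i X l j
    v≤cand = candidate-lowerBound isB optimal
    w≡v : w ≡ v
    w≡v = ≤-antisym w≤v (subst (v ≤∞_) cand≡w (v≤cand cj∈X refl))
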